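{- Let $D$ be a digraph. Then $\langle D\rangle$ is $\mathscr{R}$-trivial if and only if $D$ is acyclic.
   Context: For $a\neq b$ in $\{1,\ldots,n\}$, $(a\to b)$ denotes the transformation mapping $a$ to $b$ and fixing every other point; transformations are composed left to right. For a digraph $D$ on $\{1,\ldots,n\}$ (no loops, no multiple arcs), $\langle D\rangle$ is the semigroup generated by all $(a\to b)$ with $(a,b)$ an arc. A digraph is acyclic if it has no directed cycle. A semigroup is $\mathscr{R}$-trivial if any two elements related by Green's $\mathscr{R}$-relation are equal. -}

module Defs where

open import Data.Nat using (ℕ)
open import Data.Fin using (Fin; _≟_)
open import Data.Bool using (Bool; true; false; if_then_else_)
open import Data.Product using (Σ; _×_; _,_)
open import Data.Sum using (_⊎_)
open import Relation.Nullary using (¬_; does)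
open import Relation.Binary.PropositionalEquality using (_≡_; _≗_)
open import Relation.Binary.Construct.Closure.Transitive using (TransClosure)

-- A digraph on {1,..,n} (here Fin n): an arc relation with no loops.
-- Multiple arcs cannot occur since arcs are given by a Bool-valued relation.
record Digraph (n : ℕ) : Set where
  field
    arc      : Fin n → Fin n → Bool
    loopless : ∀ a → arc a a ≡ false
open Digraph public

Arc : ∀ {n} → Digraph n → Fin n → Fin n → Set
Arc D a b = arc D a b ≡ true

Trans : ℕ → Set
Trans n = Fin n → Fin n

-- Composition left to right: x (f · g) = (x f) g
_·_ : ∀ {n} → Trans n → Trans n → Trans n
(f · g) x = g (f x)

idT : ∀ {n} → Trans n
idT x = x

[_⇒_] : ∀ {n} → Fin n → Fin n → Trans n
[ a ⇒ b ] x = if does (x ≟ a) then b else x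

-- Membership in the semigroup ⟨D⟩ generated by the (a → b), (a,b) an arc.
-- Transformations are compared extensionally (pointwise).
data In⟨_⟩ {n : ℕ} (D : Digraph n) : Trans n → Set where
  gen  : ∀ {a b f} → Arc D a b → f ≗ [ a ⇒ b ] → In⟨ D ⟩ f
  comp : ∀ {f g h} → In⟨ D ⟩ f → In⟨ D ⟩ g → h ≗ (f · g) → In⟨ D ⟩ h

-- Green's preorder: t ∈ s S¹ inside S = ⟨D⟩
≤R⟨_⟩ : ∀ {n} → Digraph n → Trans n → Trans n → Set
≤R⟨ D ⟩ t s = (t ≗ s) ⊎ Σ (Trans _) (λ u → In⟨ D ⟩ u × (t ≗ (s · u)))

R⟨_⟩ : ∀ {n} → Digraph n → Trans n → Trans n → Set
R⟨ D ⟩ s t = ≤R⟨ D ⟩ t s × ≤R⟨ D ⟩ s t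

RTrivial : ∀ {n} → Digraph n → Set
RTrivial D = ∀ s t → In⟨ D ⟩ s → In⟨ D ⟩ t → R⟨ D ⟩ s t → s ≗ t

Acyclic : ∀ {n} → Digraph n → Set
Acyclic D = ∀ a → ¬ TransClosure (Arc D) a a

module Submission where

-- Write  Reach x y  for "y is reachable from x by a (possibly empty)
-- directed walk".
--
-- (⇐) Every generator (a → b) moves each point along an arc or fixes it,
--     so every element f of ⟨D⟩ satisfies  Reach z (f z)  for all z.  If
--     t ≤R s, i.e. t = s·u, then  Reach (s z) (t z).  In an acyclic digraph
--     Reach is antisymmetric, so s R t forces s z = t z for every z.
--
-- (⇒) A walk c → ⋯ → a yields the product P of the generators along it;
--     P collapses c to a (it sends c to a and every point to itself or
--     to a), hence P is idempotent and  P(c) = P(a).  Given a cycle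
--     a → b → ⋯ → a, take P collapsing b to a and x = (a → b).  Then
--     P·x·P = P, so P R P·x; R-triviality gives P = P·x, and evaluating
--     at a yields a = b, contradicting looplessness.

open import Defs
open import Data.Nat using (ℕ)
open import Data.Product using (Σ; _×_; _,_; proj₁)
open import Data.Sum using (_⊎_; inj₁; inj₂) renaming (map to map-⊎)
open import Data.Fin using (Fin; _≟_)
open import Data.Empty using (⊥-elim)
open import Relation.Nullary using (yes; no)
open import Relation.Nullary.Decidable using (dec-true)
open import Relation.Binary.PropositionalEquality
open import Relation.Binary.Construct.Closure.Transitive using (TransClosure; [_]; _∷_; _++_)

⇒-source : ∀ {n} (a b : Fin n) → [ a ⇒ b ] a ≡ b
⇒-source a b rewrite dec-true (a ≟ a) refl = refl

⇒-cases : ∀ {n} (a b z : Fin n) → (z ≡ a × [ a ⇒ b ] z ≡ b) ⊎ [ a ⇒ b ] z ≡ z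
⇒-cases a b z with z ≟ a
... | yes z≡a = inj₁ (z≡a , refl)
... | no  _   = inj₂ refl

⇒-absorbed : ∀ {n} {a b : Fin n} (P : Trans n) → P a ≡ P b → ([ a ⇒ b ] · P) ≗ P
⇒-absorbed {a = a} {b} P Pa≡Pb z with ⇒-cases a b z
... | inj₁ (refl , hit) = trans (cong P hit) (sym Pa≡Pb)
... | inj₂ miss         = cong P miss

Collapses : ∀ {n} → Fin n → Fin n → Trans n → Set
Collapses c a P = P c ≡ a × (∀ z → P z ≡ z ⊎ P z ≡ a)

collapse-target : ∀ {n} {c a : Fin n} {P : Trans n} → Collapses c a P → P a ≡ a
collapse-target (_ , onto) with onto _
... | inj₁ Pa≡a = Pa≡a
... | inj₂ Pa≡a = Pa≡a

collapse-idempotent : ∀ {n} {c a : Fin n} {P : Trans n} → Collapses c a P → (P · P) ≗ P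
collapse-idempotent {P = P} col@(_ , onto) z with onto z
... | inj₁ Pz≡z = cong P Pz≡z
... | inj₂ Pz≡a = trans (cong P Pz≡a) (trans (collapse-target col) (sym Pz≡a))

collapse-prepend : ∀ {n} {c d a : Fin n} {P : Trans n} →
                   Collapses d a P → Collapses c a ([ c ⇒ d ] · P)
collapse-prepend {c = c} {d} {a} {P} (Pd≡a , onto) = sends , onto′
  where
  sends : P ([ c ⇒ d ] c) ≡ a
  sends = trans (cong P (⇒-source c d)) Pd≡a
  onto′ : ∀ z → P ([ c ⇒ d ] z) ≡ z ⊎ P ([ c ⇒ d ] z) ≡ a
  onto′ z with ⇒-cases c d z
  ... | inj₁ (_ , hit) = inj₂ (trans (cong P hit) Pd≡a)
  ... | inj₂ miss      = map-⊎ (trans (cong P miss)) (trans (cong P miss)) (onto z)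

idT-collapses : ∀ {n} (a : Fin n) → Collapses a a idT
idT-collapses a = refl , λ _ → inj₁ refl

module _ {n : ℕ} (D : Digraph n) where

  Walk : Fin n → Fin n → Set
  Walk = TransClosure (Arc D)

  walk-collapse : ∀ {c a} → Walk c a → Σ (Trans n) λ P → In⟨ D ⟩ P × Collapses c a P
  walk-collapse {c} {a} [ c→a ] =
    [ c ⇒ a ] · idT , gen c→a (λ _ → refl) , collapse-prepend (idT-collapses a)
  walk-collapse {c} (_∷_ {y = d} c→d w) with walk-collapse w
  ... | P , P∈D , col = [ c ⇒ d ] · P , comp (gen c→d (λ _ → refl)) P∈D (λ _ → refl)
                      , collapse-prepend col

  RTrivial-absorb : RTrivial D → ∀ {s x} → In⟨ D ⟩ s → In⟨ D ⟩ x →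
                    ((s · x) · s) ≗ s → s ≗ (s · x)
  RTrivial-absorb rt {s} {x} s∈D x∈D sxs≗s =
    rt s (s · x) s∈D (comp s∈D x∈D (λ _ → refl))
       (inj₂ (x , x∈D , λ _ → refl) , inj₂ (s , s∈D , λ z → sym (sxs≗s z)))

  arc-irreflexive : ∀ {a b} → Arc D a b → a ≢ b
  arc-irreflexive {a} a→b refl with trans (sym a→b) (loopless D a)
  ... | ()

  -- A cycle a → b → ⋯ → a with P collapsing b to a gives P R P·(a → b);
  -- R-triviality then forces a = b, which looplessness forbids.
  RTrivial⇒Acyclic : RTrivial D → Acyclic D
  RTrivial⇒Acyclic rt a [ a→a ] = arc-irreflexive a→a refl
  RTrivial⇒Acyclic rt a (_∷_ {y = b} a→b w) with walk-collapse w
  ... | P , P∈D , col = arc-irreflexive a→b a≡b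
    where
    x : Trans n
    x = [ a ⇒ b ]
    Pa≡Pb : P a ≡ P b
    Pa≡Pb = trans (collapse-target col) (sym (proj₁ col))
    -- (P·x·P) z = P (x (P z)) = P (P z) = P z
    PxP≗P : ((P · x) · P) ≗ P
    PxP≗P z = trans (⇒-absorbed P Pa≡Pb (P z)) (collapse-idempotent col z)
    a≡b : a ≡ b
    a≡b = begin
      a           ≡⟨ sym (collapse-target col) ⟩
      P a         ≡⟨ RTrivial-absorb rt P∈D (gen a→b (λ _ → refl)) PxP≗P a ⟩
      x (P a)     ≡⟨ cong x (collapse-target col) ⟩
      x a         ≡⟨ ⇒-source a b ⟩
      b           ∎
      where open ≡-Reasoning

  Reach : Fin n → Fin n → Set
  Reach z w = z ≡ w ⊎ Walk z w

  reach-trans : ∀ {x y z} → Reach x y → Reach y z → Reach x z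
  reach-trans (inj₁ refl) q           = q
  reach-trans (inj₂ p)    (inj₁ refl) = inj₂ p
  reach-trans (inj₂ p)    (inj₂ q)    = inj₂ (p ++ q)

  reach-antisym : Acyclic D → ∀ {x y} → Reach x y → Reach y x → x ≡ y
  reach-antisym ac (inj₁ x≡y) _           = x≡y
  reach-antisym ac (inj₂ p)   (inj₁ refl) = ⊥-elim (ac _ p)
  reach-antisym ac (inj₂ p)   (inj₂ q)    = ⊥-elim (ac _ (p ++ q))

  moves-forward : ∀ {f} → In⟨ D ⟩ f → ∀ z → Reach z (f z)
  moves-forward (gen {a} {b} a→b f≗ab) z rewrite f≗ab z with ⇒-cases a b z
  ... | inj₁ (refl , hit) = inj₂ (subst (Walk z) (sym hit) [ a→b ])
  ... | inj₂ miss         = inj₁ (sym miss)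
  moves-forward (comp {f} f∈D g∈D h≗fg) z rewrite h≗fg z =
    reach-trans (moves-forward f∈D z) (moves-forward g∈D (f z))

  ≤R-forward : ∀ {s t} → ≤R⟨ D ⟩ t s → ∀ z → Reach (s z) (t z)
  ≤R-forward     (inj₁ t≗s)              z = inj₁ (sym (t≗s z))
  ≤R-forward {s} (inj₂ (u , u∈D , t≗su)) z =
    subst (Reach (s z)) (sym (t≗su z)) (moves-forward u∈D (s z))

  -- If s R t then s z and t z are mutually reachable, hence equal.
  Acyclic⇒RTrivial : Acyclic D → RTrivial D
  Acyclic⇒RTrivial ac s t _ _ (t≤s , s≤t) z =
    reach-antisym ac (≤R-forward t≤s z) (≤R-forward s≤t z)

proposition4p3 : (n : ℕ) (D : Digraph n) → (RTrivial D → Acyclic D) × (Acyclic D → RTrivial D)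
proposition4p3 n D = RTrivial⇒Acyclic D , Acyclic⇒RTrivial D
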